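{- Let $q\ge 3$ be an odd integer. For every $p\ge 1$ the graph $G_{q,p}$ is $P_{3q-1}$-free, $S_{2,2,2}$-free, and $S_{3(q-1)/2,\,3(q-1)/2,\,1}$-free.
   Context: All graphs are finite and simple; a graph is $F$-free if it does not contain $F$ as an induced subgraph. $P_t$ is the path on $t$ vertices. For integers $a,b,c\ge 1$, $S_{a,b,c}$ is the graph obtained from the paths $P_{a+1},P_{b+1},P_{c+1}$ by identifying one endvertex of each of them into a single vertex. For odd $q\ge 3$ and $p\ge 1$, $G_{q,p}$ is the graph with vertex set $\{0,1,\dots,qp-3\}$, where arithmetic on vertices is modulo $qp-2$, in which the neighborhood of each vertex $i$ is $N(i)=\{i-1,i+1\}\cup\{i+qj-1 : j\in\{1,\dots,p-1\}\}$. -}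

module Defs where

open import Data.Nat using (ℕ; zero; suc; _+_; _*_; _∸_; _≤_; _≡ᵇ_)
open import Data.Fin using (Fin; toℕ)
open import Data.Integer using (ℤ; +_; _-_)
open import Data.Integer.Divisibility using (_∣_)
open import Data.Product using (Σ; _×_; ∃-syntax)
open import Data.Sum using (_⊎_)
open import Relation.Binary.PropositionalEquality using (_≡_; _≢_)
open import Relation.Nullary using (¬_)
open import Function.Bundles using (_⇔_)

-- A graph is given by a vertex type and an adjacency relation.
-- (All graphs constructed below are finite, simple: irreflexive, symmetric.)
record Graph : Set₁ where
  field
    V   : Set
    Adj : V → V → Set
open Graph public

InducedSub : Graph → Graph → Set
InducedSub H G =
  Σ (V H → V G) λ f →
    (∀ x y → f x ≡ f y → x ≡ y) ×
    (∀ x y → Adj H x y ⇔ Adj G (f x) (f y))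

_-free_ : Graph → Graph → Set
H -free G = ¬ InducedSub H G

Consec : {n : ℕ} → Fin n → Fin n → Set
Consec i j = (suc (toℕ i) ≡ toℕ j) ⊎ (suc (toℕ j) ≡ toℕ i)

P : ℕ → Graph
P t = record { V = Fin t ; Adj = Consec }

-- S_{a,b,c}: a centre with three pendant paths having a, b, c further
-- vertices respectively (leg ℓ vertex at position i is at distance i+1
-- from the centre).
data SpiderV (a b c : ℕ) : Set where
  centre : SpiderV a b c
  leg1   : Fin a → SpiderV a b c
  leg2   : Fin b → SpiderV a b c
  leg3   : Fin c → SpiderV a b c

data SpiderAdj {a b c : ℕ} : SpiderV a b c → SpiderV a b c → Set where
  c-1 : (i : Fin a) → toℕ i ≡ 0 → SpiderAdj centre (leg1 i)
  c-2 : (i : Fin b) → toℕ i ≡ 0 → SpiderAdj centre (leg2 i)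
  c-3 : (i : Fin c) → toℕ i ≡ 0 → SpiderAdj centre (leg3 i)
  1-c : (i : Fin a) → toℕ i ≡ 0 → SpiderAdj (leg1 i) centre
  2-c : (i : Fin b) → toℕ i ≡ 0 → SpiderAdj (leg2 i) centre
  3-c : (i : Fin c) → toℕ i ≡ 0 → SpiderAdj (leg3 i) centre
  1-1 : (i j : Fin a) → Consec i j → SpiderAdj (leg1 i) (leg1 j)
  2-2 : (i j : Fin b) → Consec i j → SpiderAdj (leg2 i) (leg2 j)
  3-3 : (i j : Fin c) → Consec i j → SpiderAdj (leg3 i) (leg3 j)

S : ℕ → ℕ → ℕ → Graph
S a b c = record { V = SpiderV a b c ; Adj = SpiderAdj }

infix 4 _≡ₘ_[mod_]
_≡ₘ_[mod_] : ℤ → ℤ → ℕ → Set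
x ≡ₘ y [mod m ] = (+ m) ∣ (x - y)

GAdj : (q p : ℕ) → Fin (q * p ∸ 2) → Fin (q * p ∸ 2) → Set
GAdj q p i j =
  (i ≢ j) ×
  ( (+ toℕ j ≡ₘ (+ toℕ i) - (+ 1) [mod m ])
  ⊎ (+ toℕ j ≡ₘ (+ toℕ i) Data.Integer.+ (+ 1) [mod m ])
  ⊎ (∃[ k ] ((1 ≤ k) × (k ≤ p ∸ 1) ×
       (+ toℕ j ≡ₘ (+ toℕ i) Data.Integer.+ (+ (q * k ∸ 1)) [mod m ]))) )
  where m = q * p ∸ 2

Gqp : ℕ → ℕ → Graph
Gqp q p = record { V = Fin (q * p ∸ 2) ; Adj = GAdj q p }

{-# OPTIONS --safe #-}
module Submission where

open import Defs

-- Write q = 2c + 1 and m = qp − 2, and read vertices as integers modulo m. Every edge of G_{q,p}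
-- is then an arrow y ≡ x + qτ − 1 with 0 ≤ τ ≤ p, and arrows compose additively. Along an induced
-- path X₀ … X_{6c} with arrow parameters t_l, three consecutive arrows add up to an arrow with
-- parameter T_i − p, where T_i = t_i + t_{i+1} + t_{i+2}; so no T_i lies in [p, 2p], and since
-- consecutive T_i differ by at most p, all of them lie on the same side. Negating all vertices
-- replaces t by p − t, so we may assume T_i > 2p throughout. Because q (cp − 1) ≡ −1, the vertex
-- X_{2s} is adjacent to X₀ as soon as the drift t₀ + … + t_{2s−1} − sp lies in [cp − 1, cp − 1 + p];
-- the drift starts at 0, rises by at most p per step and exceeds cp − 1 after 3c steps, so it hits
-- this window. Hence G_{q,p} has no induced path on 6c + 1 vertices, while both P_{3q−1} and
-- S_{3c,3c,1} contain one. For S_{2,2,2}: if the centre reaches its three neighbours by arrows with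
-- parameters α ≤ β ≤ γ, the pendant vertex of the middle leg is adjacent to the first or the third
-- neighbour.

module _ where
  open import Data.Nat as ℕ using (ℕ; zero; suc; z≤n; s≤s)
  import Data.Nat.Properties as ℕ
  open import Data.Integer using (ℤ; +_; +≤+; 0ℤ; 1ℤ; _+_; _-_; _*_; -_; _≤_; _<_; _≤?_; _<?_)
  import Data.Integer.Properties as ℤ
  open import Data.Integer.Divisibility.Signed using (_∣_; ∣-refl; ∣m∣n⇒∣m+n; ∣m⇒∣-m; ∣n⇒∣m*n)
  open import Data.Integer.Tactic.RingSolver using (solve-∀)
  open import Data.Fin using (Fin)
  open import Data.Fin.Patterns using (0F; 1F; 2F)
  open import Data.Product using (_×_; _,_; proj₁; proj₂; ∃-syntax)
  open import Data.Sum using (_⊎_; inj₁; inj₂)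
  open import Data.Empty using (⊥; ⊥-elim)
  open import Function using (_∘_)
  open import Relation.Binary.Bundles using (Setoid)
  open import Relation.Binary.Structures using (IsEquivalence)
  open import Relation.Binary.PropositionalEquality using (_≡_; _≢_; refl; sym; cong; subst; subst₂)
  open import Relation.Nullary using (¬_; yes; no)
  import Relation.Binary.Reasoning.Setoid as SetoidReasoning

  infix 4 _∈[_,_]
  _∈[_,_] : ℤ → ℤ → ℤ → Set
  x ∈[ a , b ] = a ≤ x × x ≤ b

  ≤-by-difference : ∀ {a b d} → b - a ≡ d → 0ℤ ≤ d → a ≤ b
  ≤-by-difference b-a≡d 0≤d = ℤ.0≤i-j⇒j≤i (subst (0ℤ ≤_) (sym b-a≡d) 0≤d)

  window-shift : ∀ {x a d} → x ∈[ a , a + d ] → x - a ∈[ 0ℤ , d ]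
  window-shift {x} {a} {d} (a≤x , x≤a+d) =
    ℤ.i≤j⇒0≤j-i a≤x , ≤-by-difference (lemma x a d) (ℤ.i≤j⇒0≤j-i x≤a+d)
    where lemma : ∀ x a d → d - (x - a) ≡ (a + d) - x
          lemma = solve-∀

  hits-window : (f : ℕ → ℤ) (d h : ℤ) → (∀ s → f (suc s) ≤ f s + d) →
    ∀ {n} → 1 ℕ.≤ n → f 0 ≤ h → h ≤ f n → ∃[ s ] (1 ℕ.≤ s × s ℕ.≤ n × f s ∈[ h , h + d ])
  hits-window f d h step {suc n} _ f₀≤h = descend n
    where
    descend : ∀ n → h ≤ f (suc n) → ∃[ s ] (1 ℕ.≤ s × s ℕ.≤ suc n × f s ∈[ h , h + d ])
    descend zero h≤f₁ = 1 , ℕ.≤-refl , ℕ.≤-refl , h≤f₁ , ℤ.≤-trans (step 0) (ℤ.+-monoˡ-≤ d f₀≤h)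
    descend (suc n) h≤f with h ≤? f (suc n)
    ... | yes h≤f′ = let s , 1≤s , s≤n , hit = descend n h≤f′ in s , 1≤s , ℕ.m≤n⇒m≤1+n s≤n , hit
    ... | no  h≰f′ = suc (suc n) , s≤s z≤n , ℕ.≤-refl , h≤f ,
                     ℤ.≤-trans (step (suc n)) (ℤ.+-monoˡ-≤ d (ℤ.<⇒≤ (ℤ.≰⇒> h≰f′)))

  median-window : ∀ {α β γ δ P} → 0ℤ ≤ α → α ≤ β → β ≤ γ → γ ≤ P → δ ∈[ 0ℤ , P ] →
    β + δ - α ∈[ 0ℤ , P ] ⊎ β + δ - γ ∈[ 0ℤ , P ]
  median-window {α} {β} {γ} {δ} {P} 0≤α α≤β β≤γ γ≤P (0≤δ , δ≤P) with β + δ - α ≤? P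
  ... | yes ≤P = inj₁ (≤-by-difference (lower-gap α β δ) (ℤ.+-mono-≤ (ℤ.i≤j⇒0≤j-i α≤β) 0≤δ) , ≤P)
    where lower-gap : ∀ α β δ → (β + δ - α) - 0ℤ ≡ (β - α) + δ
          lower-gap = solve-∀
  ... | no ≰P = inj₂ (≤-by-difference (lower-gap α β γ δ P) 0≤τ , ≤-by-difference (upper-gap β γ δ P) τ≤P)
    where
      0≤τ = ℤ.+-mono-≤ (ℤ.+-mono-≤ (ℤ.i≤j⇒0≤j-i (ℤ.<⇒≤ (ℤ.≰⇒> ≰P))) (ℤ.i≤j⇒0≤j-i γ≤P)) 0≤α
      τ≤P = ℤ.+-mono-≤ (ℤ.i≤j⇒0≤j-i β≤γ) (ℤ.i≤j⇒0≤j-i δ≤P)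
      lower-gap : ∀ α β γ δ P → (β + δ - γ) - 0ℤ ≡ (((β + δ - α) - P) + (P - γ)) + α
      lower-gap = solve-∀
      upper-gap : ∀ β γ δ P → P - (β + δ - γ) ≡ (γ - β) + (P - δ)
      upper-gap = solve-∀

  median-of-three : (τ : Fin 3 → ℤ) →
    ∃[ x ] ∃[ y ] ∃[ z ] (x ≢ y × z ≢ y × τ x ≤ τ y × τ y ≤ τ z)
  median-of-three τ with ℤ.≤-total (τ 0F) (τ 1F) | ℤ.≤-total (τ 1F) (τ 2F) | ℤ.≤-total (τ 0F) (τ 2F)
  ... | inj₁ τ₀≤τ₁ | inj₁ τ₁≤τ₂ | _          = 0F , 1F , 2F , (λ ()) , (λ ()) , τ₀≤τ₁ , τ₁≤τ₂
  ... | inj₁ _     | inj₂ τ₂≤τ₁ | inj₁ τ₀≤τ₂ = 0F , 2F , 1F , (λ ()) , (λ ()) , τ₀≤τ₂ , τ₂≤τ₁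
  ... | inj₁ τ₀≤τ₁ | inj₂ _     | inj₂ τ₂≤τ₀ = 2F , 0F , 1F , (λ ()) , (λ ()) , τ₂≤τ₀ , τ₀≤τ₁
  ... | inj₂ τ₁≤τ₀ | inj₁ _     | inj₁ τ₀≤τ₂ = 1F , 0F , 2F , (λ ()) , (λ ()) , τ₁≤τ₀ , τ₀≤τ₂
  ... | inj₂ _     | inj₁ τ₁≤τ₂ | inj₂ τ₂≤τ₀ = 1F , 2F , 0F , (λ ()) , (λ ()) , τ₁≤τ₂ , τ₂≤τ₀
  ... | inj₂ τ₁≤τ₀ | inj₂ τ₂≤τ₁ | _          = 2F , 1F , 0F , (λ ()) , (λ ()) , τ₂≤τ₁ , τ₁≤τ₀

  module Congruence (M : ℤ) where

    infix 4 _≈_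
    record _≈_ (x y : ℤ) : Set where
      constructor by-divisibility
      field
        divides-difference : M ∣ x - y

    private
      by-identity : ∀ {x y d} → d ≡ x - y → M ∣ d → x ≈ y
      by-identity d≡x-y M∣d = by-divisibility (subst (M ∣_) d≡x-y M∣d)

    ≈-reflexive : ∀ {x y} → x ≡ y → x ≈ y
    ≈-reflexive {x} refl = by-identity (lemma x) (∣n⇒∣m*n 0ℤ ∣-refl)
      where lemma : ∀ x → 0ℤ * M ≡ x - x
            lemma = solve-∀

    ≈-sym : ∀ {x y} → x ≈ y → y ≈ x
    ≈-sym {x} {y} (by-divisibility M∣x-y) = by-identity (lemma x y) (∣m⇒∣-m M∣x-y)
      where lemma : ∀ x y → - (x - y) ≡ y - x
            lemma = solve-∀

    ≈-trans : ∀ {x y z} → x ≈ y → y ≈ z → x ≈ z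
    ≈-trans {x} {y} {z} (by-divisibility M∣x-y) (by-divisibility M∣y-z) =
      by-identity (lemma x y z) (∣m∣n⇒∣m+n M∣x-y M∣y-z)
      where lemma : ∀ x y z → (x - y) + (y - z) ≡ x - z
            lemma = solve-∀

    ≈-isEquivalence : IsEquivalence _≈_
    ≈-isEquivalence = record { refl = ≈-reflexive refl ; sym = ≈-sym ; trans = ≈-trans }

    ≈-setoid : Setoid _ _
    ≈-setoid = record { isEquivalence = ≈-isEquivalence }

    +-cong : ∀ {x y u v} → x ≈ y → u ≈ v → x + u ≈ y + v
    +-cong {x} {y} {u} {v} (by-divisibility M∣x-y) (by-divisibility M∣u-v) =
      by-identity (lemma x y u v) (∣m∣n⇒∣m+n M∣x-y M∣u-v)
      where lemma : ∀ x y u v → (x - y) + (u - v) ≡ (x + u) - (y + v)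
            lemma = solve-∀

    +-congˡ : ∀ z {x y} → x ≈ y → z + x ≈ z + y
    +-congˡ z = +-cong (≈-reflexive {z} refl)

    +-congʳ : ∀ z {x y} → x ≈ y → x + z ≈ y + z
    +-congʳ z x≈y = +-cong x≈y (≈-reflexive {z} refl)

    neg-cong : ∀ {x y} → x ≈ y → - x ≈ - y
    neg-cong {x} {y} (by-divisibility M∣x-y) = by-identity (lemma x y) (∣m⇒∣-m M∣x-y)
      where lemma : ∀ x y → - (x - y) ≡ - x - - y
            lemma = solve-∀

    +-multiple : ∀ x k → x + k * M ≈ x
    +-multiple x k = by-identity (lemma x k M) (∣n⇒∣m*n k ∣-refl)
      where lemma : ∀ x k M → k * M ≡ (x + k * M) - x
            lemma = solve-∀

  module Arrows (q p : ℕ) where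

    M : ℤ
    M = + q * + p - + 2

    open Congruence M public
    open SetoidReasoning ≈-setoid

    -- τ = 0 and τ = p give the cycle edges to x − 1 and x + 1, since qp − 1 ≡ 1.
    D : ℤ → ℤ
    D τ = + q * τ - 1ℤ

    Linked : ℤ → ℤ → Set
    Linked x y = ∃[ τ ] (τ ∈[ 0ℤ , + p ] × y ≈ x + D τ)

    reflect-range : ∀ {τ} → τ ∈[ 0ℤ , + p ] → + p - τ ∈[ 0ℤ , + p ]
    reflect-range {τ} (0≤τ , τ≤p) = ℤ.i≤j⇒0≤j-i τ≤p , ≤-by-difference (lemma τ (+ p)) 0≤τ
      where lemma : ∀ τ p → p - (p - τ) ≡ τ
            lemma = solve-∀

    reflect-arrow : ∀ {x y τ} → y ≈ x + D τ → - y ≈ - x + D (+ p - τ)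
    reflect-arrow {x} {y} {τ} y≈x+Dτ = begin
      - y                                  ≈⟨ neg-cong y≈x+Dτ ⟩
      - (x + D τ)                          ≡⟨ lemma x τ (+ q) (+ p) ⟩
      - x + D (+ p - τ) + - 1ℤ * M         ≈⟨ +-multiple _ (- 1ℤ) ⟩
      - x + D (+ p - τ)                    ∎
      where lemma : ∀ x τ q p → - (x + (q * τ - 1ℤ)) ≡ - x + (q * (p - τ) - 1ℤ) + - 1ℤ * (q * p - + 2)
            lemma = solve-∀

    Linked-neg : ∀ {x y} → Linked x y → Linked (- x) (- y)
    Linked-neg {x} (τ , τ∈ , y≈) = + p - τ , reflect-range τ∈ , reflect-arrow {x} y≈

    arrow-to-nephew : ∀ {c y₁ y₂ z α β δ} → y₁ ≈ c + D α → y₂ ≈ c + D β → z ≈ y₂ + D δ →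
      z ≈ y₁ + D (β + δ - α)
    arrow-to-nephew {c} {y₁} {y₂} {z} {α} {β} {δ} y₁≈ y₂≈ z≈ = begin
      z                                    ≈⟨ z≈ ⟩
      y₂ + D δ                             ≈⟨ +-congʳ (D δ) y₂≈ ⟩
      c + D β + D δ                        ≡⟨ lemma c α β δ (+ q) ⟩
      c + D α + D (β + δ - α)              ≈⟨ +-congʳ (D (β + δ - α)) (≈-sym y₁≈) ⟩
      y₁ + D (β + δ - α)                   ∎
      where lemma : ∀ c α β δ q → c + (q * β - 1ℤ) + (q * δ - 1ℤ) ≡
                      c + (q * α - 1ℤ) + (q * (β + δ - α) - 1ℤ)
            lemma = solve-∀

    middle-nephew-linked : ∀ {c y₁ y₂ y₃ z α β γ δ} → α ≤ β → β ≤ γ →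
      α ∈[ 0ℤ , + p ] → γ ∈[ 0ℤ , + p ] → δ ∈[ 0ℤ , + p ] →
      y₁ ≈ c + D α → y₂ ≈ c + D β → y₃ ≈ c + D γ → z ≈ y₂ + D δ →
      Linked y₁ z ⊎ Linked y₃ z
    middle-nephew-linked {c} α≤β β≤γ (0≤α , _) (_ , γ≤p) δ∈ y₁≈ y₂≈ y₃≈ z≈
      with median-window 0≤α α≤β β≤γ γ≤p δ∈
    ... | inj₁ τ∈ = inj₁ (_ , τ∈ , arrow-to-nephew {c} y₁≈ y₂≈ z≈)
    ... | inj₂ τ∈ = inj₂ (_ , τ∈ , arrow-to-nephew {c} y₃≈ y₂≈ z≈)

    claw-linked : ∀ {c} {y z : Fin 3 → ℤ} → (∀ x → Linked c (y x)) → (∀ x → Linked (y x) (z x)) →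
      ∃[ x ] ∃[ x′ ] (x ≢ x′ × Linked (y x) (z x′))
    claw-linked {c} root tip with median-of-three (proj₁ ∘ root)
    ... | x , m , x′ , x≢m , x′≢m , τx≤τm , τm≤τx′
      with middle-nephew-linked {c} τx≤τm τm≤τx′
             (proj₁ (proj₂ (root x))) (proj₁ (proj₂ (root x′))) (proj₁ (proj₂ (tip m)))
             (proj₂ (proj₂ (root x))) (proj₂ (proj₂ (root m))) (proj₂ (proj₂ (root x′))) (proj₂ (proj₂ (tip m)))
    ... | inj₁ linked = x , m , x≢m , linked
    ... | inj₂ linked = x′ , m , x′≢m , linked

  module Chains (c p : ℕ) where

    q : ℕ
    q = 1 ℕ.+ c ℕ.* 2

    open Arrows q p
    open SetoidReasoning ≈-setoid

    -- Written (c · 3) · 2 rather than 6c so that (suc k · 3) · 2 unfolds to 6 + (k · 3) · 2.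
    N : ℕ
    N = c ℕ.* 3 ℕ.* 2

    h : ℤ
    h = + c * + p - 1ℤ

    record IsChain (X t : ℕ → ℤ) : Set where
      field
        range    : ∀ l → t l ∈[ 0ℤ , + p ]
        arrow    : ∀ {l} → l ℕ.< N → X (suc l) ≈ X l + D (t l)
        unlinked : ∀ {i j} → 2 ℕ.+ i ℕ.≤ j → j ℕ.≤ N → ¬ Linked (X i) (X j)

    arrow-sum : (ℕ → ℤ) → ℕ → ℤ
    arrow-sum t zero    = 0ℤ
    arrow-sum t (suc l) = arrow-sum t l + D (t l)

    triple : (ℕ → ℤ) → ℕ → ℤ
    triple t i = t i + t (1 ℕ.+ i) + t (2 ℕ.+ i)

    drift : (ℕ → ℤ) → ℕ → ℤ
    drift t zero    = 0ℤ
    drift t (suc s) = drift t s + (t (s ℕ.* 2) + t (1 ℕ.+ s ℕ.* 2) - + p)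

    arrow-sum≈drift : ∀ t s → arrow-sum t (s ℕ.* 2) ≈ + q * drift t s
    arrow-sum≈drift t zero    = ≈-reflexive (sym (ℤ.*-zeroʳ (+ q)))
    arrow-sum≈drift t (suc s) = begin
      arrow-sum t (s ℕ.* 2) + D (t (s ℕ.* 2)) + D (t (1 ℕ.+ s ℕ.* 2))
        ≈⟨ +-congʳ (D (t (1 ℕ.+ s ℕ.* 2))) (+-congʳ (D (t (s ℕ.* 2))) (arrow-sum≈drift t s)) ⟩
      + q * drift t s + D (t (s ℕ.* 2)) + D (t (1 ℕ.+ s ℕ.* 2))
        ≡⟨ lemma (drift t s) (t (s ℕ.* 2)) (t (1 ℕ.+ s ℕ.* 2)) (+ q) (+ p) ⟩
      + q * drift t (suc s) + 1ℤ * M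
        ≈⟨ +-multiple _ 1ℤ ⟩
      + q * drift t (suc s) ∎
      where lemma : ∀ d u v q p → q * d + (q * u - 1ℤ) + (q * v - 1ℤ) ≡
                      q * (d + (u + v - p)) + 1ℤ * (q * p - + 2)
            lemma = solve-∀

    module _ {X t : ℕ → ℤ} (chain : IsChain X t) where
      open IsChain chain

      walk : ∀ k → k ℕ.≤ N → X k ≈ X 0 + arrow-sum t k
      walk zero    _   = ≈-reflexive (sym (ℤ.+-identityʳ (X 0)))
      walk (suc k) k<N = begin
        X (suc k)                          ≈⟨ arrow k<N ⟩
        X k + D (t k)                      ≈⟨ +-congʳ (D (t k)) (walk k (ℕ.<⇒≤ k<N)) ⟩
        X 0 + arrow-sum t k + D (t k)      ≡⟨ ℤ.+-assoc (X 0) _ _ ⟩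
        X 0 + arrow-sum t (suc k)          ∎

      three-linked : ∀ i → 3 ℕ.+ i ℕ.≤ N → triple t i - + p ∈[ 0ℤ , + p ] →
        Linked (X i) (X (3 ℕ.+ i))
      three-linked i 3+i≤N τ∈ = triple t i - + p , τ∈ , (begin
        X (3 ℕ.+ i)
          ≈⟨ walk (3 ℕ.+ i) 3+i≤N ⟩
        X 0 + arrow-sum t (3 ℕ.+ i)
          ≡⟨ lemma (X 0) (arrow-sum t i) (t i) (t (1 ℕ.+ i)) (t (2 ℕ.+ i)) (+ q) (+ p) ⟩
        X 0 + arrow-sum t i + D (triple t i - + p) + 1ℤ * M
          ≈⟨ +-multiple _ 1ℤ ⟩
        X 0 + arrow-sum t i + D (triple t i - + p)
          ≈⟨ +-congʳ (D (triple t i - + p)) (≈-sym (walk i (ℕ.≤-trans (ℕ.m≤n+m i 3) 3+i≤N))) ⟩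
        X i + D (triple t i - + p) ∎)
        where lemma : ∀ x a u v w q p → x + (a + (q * u - 1ℤ) + (q * v - 1ℤ) + (q * w - 1ℤ)) ≡
                        x + a + (q * (u + v + w - p) - 1ℤ) + 1ℤ * (q * p - + 2)
              lemma = solve-∀

      -- q (cp − 1) + 1 = c (qp − 2): the one place where q = 2c + 1 matters.
      even-linked : ∀ s → s ℕ.* 2 ℕ.≤ N → drift t s - h ∈[ 0ℤ , + p ] →
        Linked (X 0) (X (s ℕ.* 2))
      even-linked s 2s≤N τ∈ = drift t s - h , τ∈ , (begin
        X (s ℕ.* 2)                         ≈⟨ walk (s ℕ.* 2) 2s≤N ⟩
        X 0 + arrow-sum t (s ℕ.* 2)         ≈⟨ +-congˡ (X 0) (arrow-sum≈drift t s) ⟩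
        X 0 + + q * drift t s               ≡⟨ identity ⟩
        X 0 + D (drift t s - h) + + c * M   ≈⟨ +-multiple _ (+ c) ⟩
        X 0 + D (drift t s - h)             ∎)
        where
          lemma : ∀ x d c p → x + (1ℤ + c * + 2) * d ≡
            x + ((1ℤ + c * + 2) * (d - (c * p - 1ℤ)) - 1ℤ) + c * ((1ℤ + c * + 2) * p - + 2)
          lemma = solve-∀
          identity : X 0 + + q * drift t s ≡ X 0 + D (drift t s - h) + + c * M
          identity = subst (λ Q → X 0 + Q * drift t s ≡
                                  X 0 + (Q * (drift t s - h) - 1ℤ) + + c * (Q * + p - + 2))
                           (sym (cong (λ x → 1ℤ + x) (ℤ.pos-* c 2))) (lemma (X 0) (drift t s) (+ c) (+ p))

      module Ascending (T₀>2p : + p + + p < triple t 0) where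

        above : ∀ i → 3 ℕ.+ i ℕ.≤ N → + p + + p < triple t i
        above zero    _     = T₀>2p
        above (suc i) 4+i≤N with + p + + p <? triple t (suc i)
        ... | yes T>2p = T>2p
        ... | no  T≯2p = ⊥-elim (unlinked (ℕ.n≤1+n _) 4+i≤N (three-linked (suc i) 4+i≤N (lower , upper)))
          where
            previous : 1ℤ + (+ p + + p) ≤ triple t i
            previous = ℤ.i<j⇒suc[i]≤j (above i (ℕ.≤-trans (ℕ.n≤1+n _) 4+i≤N))
            lower-gap : ∀ a b c d P → (b + c + d - P) - 0ℤ ≡ d + (P - a) + (a + b + c - (1ℤ + (P + P))) + 1ℤ
            lower-gap = solve-∀
            lower : 0ℤ ≤ triple t (suc i) - + p
            lower = ≤-by-difference (lower-gap (t i) (t (1 ℕ.+ i)) (t (2 ℕ.+ i)) (t (3 ℕ.+ i)) (+ p))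
              (ℤ.+-mono-≤ (ℤ.+-mono-≤ (ℤ.+-mono-≤ (proj₁ (range (3 ℕ.+ i))) (ℤ.i≤j⇒0≤j-i (proj₂ (range i))))
                                      (ℤ.i≤j⇒0≤j-i previous))
                          (+≤+ z≤n))
            upper-gap : ∀ T P → P - (T - P) ≡ (P + P) - T
            upper-gap = solve-∀
            upper : triple t (suc i) - + p ≤ + p
            upper = ≤-by-difference (upper-gap (triple t (suc i)) (+ p)) (ℤ.i≤j⇒0≤j-i (ℤ.≮⇒≥ T≯2p))

        drift-lower : ∀ k → k ℕ.≤ c → + k * (+ p + + 2) ≤ drift t (k ℕ.* 3)
        drift-lower zero    _   = ℤ.≤-refl
        drift-lower (suc k) k<c = ≤-by-difference
            (lemma (+ k) (drift t y) (t (y ℕ.* 2)) (t (1 ℕ.+ y ℕ.* 2)) (t (2 ℕ.+ y ℕ.* 2))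
                   (t (3 ℕ.+ y ℕ.* 2)) (t (4 ℕ.+ y ℕ.* 2)) (t (5 ℕ.+ y ℕ.* 2)) (+ p))
            (ℤ.+-mono-≤ (ℤ.+-mono-≤ (ℤ.i≤j⇒0≤j-i (drift-lower k (ℕ.<⇒≤ k<c)))
                                    (block (y ℕ.* 2) (ℕ.≤-trans (ℕ.m≤n+m _ 3) 6+2y≤N)))
                        (block (3 ℕ.+ y ℕ.* 2) 6+2y≤N))
          where
            y = k ℕ.* 3
            6+2y≤N : 6 ℕ.+ y ℕ.* 2 ℕ.≤ N
            6+2y≤N = ℕ.*-monoˡ-≤ 2 (ℕ.*-monoˡ-≤ 3 k<c)
            block : ∀ i → 3 ℕ.+ i ℕ.≤ N → 0ℤ ≤ triple t i - (1ℤ + (+ p + + p))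
            block i 3+i≤N = ℤ.i≤j⇒0≤j-i (ℤ.i<j⇒suc[i]≤j (above i 3+i≤N))
            lemma : ∀ K d a₀ a₁ a₂ a₃ a₄ a₅ P →
              d + (a₀ + a₁ - P) + (a₂ + a₃ - P) + (a₄ + a₅ - P) - (1ℤ + K) * (P + + 2) ≡
              d - K * (P + + 2) + (a₀ + a₁ + a₂ - (1ℤ + (P + P))) + (a₃ + a₄ + a₅ - (1ℤ + (P + P)))
            lemma = solve-∀

        impossible : 1 ℕ.≤ c → 1 ℕ.≤ p → ⊥
        impossible 1≤c 1≤p =
          let s , 1≤s , s≤3c , hit = hits-window (drift t) (+ p) h drift-step 1≤3c 0≤h h≤drift
              2s≤N = ℕ.*-monoˡ-≤ 2 s≤3c
          in unlinked (ℕ.*-monoˡ-≤ 2 1≤s) 2s≤N (even-linked s 2s≤N (window-shift hit))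
          where
            1≤3c : 1 ℕ.≤ c ℕ.* 3
            1≤3c = ℕ.≤-trans (s≤s z≤n) (ℕ.*-monoˡ-≤ 3 1≤c)
            0≤h : 0ℤ ≤ h
            0≤h = subst (λ cp → 0ℤ ≤ cp - 1ℤ) (ℤ.pos-* c p) (ℤ.i≤j⇒0≤j-i (+≤+ (ℕ.*-mono-≤ 1≤c 1≤p)))
            target-gap : ∀ C P → C * (P + + 2) - (C * P - 1ℤ) ≡ C + C + 1ℤ
            target-gap = solve-∀
            h≤drift : h ≤ drift t (c ℕ.* 3)
            h≤drift = ℤ.≤-trans (≤-by-difference (target-gap (+ c) (+ p)) (+≤+ z≤n)) (drift-lower c ℕ.≤-refl)
            step-gap : ∀ d u v P → d + P - (d + (u + v - P)) ≡ (P - u) + (P - v)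
            step-gap = solve-∀
            drift-step : ∀ s → drift t (suc s) ≤ drift t s + + p
            drift-step s = ≤-by-difference (step-gap (drift t s) (t (s ℕ.* 2)) (t (1 ℕ.+ s ℕ.* 2)) (+ p))
              (ℤ.+-mono-≤ (ℤ.i≤j⇒0≤j-i (proj₂ (range (s ℕ.* 2))))
                          (ℤ.i≤j⇒0≤j-i (proj₂ (range (1 ℕ.+ s ℕ.* 2)))))

    IsChain-neg : ∀ {X t} → IsChain X t → IsChain (λ l → - X l) (λ l → + p - t l)
    IsChain-neg {X} {t} chain = record
      { range    = λ l → reflect-range (range l)
      ; arrow    = λ {l} l<N → reflect-arrow {X l} {X (suc l)} {t l} (arrow l<N)
      ; unlinked = λ {i} {j} 2+i≤j j≤N linked → unlinked 2+i≤j j≤N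
          (subst₂ Linked (ℤ.neg-involutive (X i)) (ℤ.neg-involutive (X j)) (Linked-neg { - X i} linked))
      }
      where open IsChain chain

    no-chain : 1 ℕ.≤ c → 1 ℕ.≤ p → ∀ {X t} → ¬ IsChain X t
    no-chain 1≤c 1≤p {X} {t} chain with + p ≤? triple t 0
    ... | no T₀≱p = Ascending.impossible (IsChain-neg chain) reflected-start 1≤c 1≤p
      where
        lemma : ∀ a b c P → (P - a) + (P - b) + (P - c) - (1ℤ + (P + P)) ≡ P - (1ℤ + (a + b + c))
        lemma = solve-∀
        reflected-start : + p + + p < triple (λ l → + p - t l) 0
        reflected-start = ℤ.suc[i]≤j⇒i<j (≤-by-difference (lemma (t 0) (t 1) (t 2) (+ p))
                            (ℤ.i≤j⇒0≤j-i (ℤ.i<j⇒suc[i]≤j (ℤ.≰⇒> T₀≱p))))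
    ... | yes p≤T₀ with triple t 0 ≤? + p + + p
    ...   | yes T₀≤2p = IsChain.unlinked chain (ℕ.n≤1+n 2) 3≤N
                          (three-linked chain 0 3≤N (window-shift (p≤T₀ , T₀≤2p)))
      where 3≤N = ℕ.≤-trans (s≤s (s≤s (s≤s z≤n))) (ℕ.*-monoˡ-≤ 2 (ℕ.*-monoˡ-≤ 3 1≤c))
    ...   | no T₀≰2p = Ascending.impossible chain (ℤ.≰⇒> T₀≰2p) 1≤c 1≤p

module _ where
  open import Data.Nat using (ℕ; suc; s≤s; s≤s⁻¹; _+_; _*_; _∸_; _≤_; _<_)
  import Data.Nat.Properties as ℕ
  open import Data.Fin using (Fin; toℕ; fromℕ<)
  open import Data.Fin.Patterns using (0F; 1F; 2F)
  open import Data.Fin.Properties using (toℕ-fromℕ<; toℕ<n)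
  open import Data.Product using (_×_; _,_)
  open import Data.Sum using (_⊎_; inj₁; inj₂)
  open import Data.Empty using (⊥-elim)
  open import Function using (id)
  open import Function.Bundles using (Equivalence)
  open import Relation.Binary.Definitions using (tri<; tri≈; tri>)
  open import Relation.Binary.PropositionalEquality using (_≡_; _≢_; refl; sym; trans; cong; subst₂)
  open import Relation.Nullary using (¬_)
  open Equivalence

  OneApart : ℕ → ℕ → Set
  OneApart m n = suc m ≡ n ⊎ suc n ≡ m

  OneApart-sym : ∀ {m n} → OneApart m n → OneApart n m
  OneApart-sym (inj₁ e) = inj₂ e
  OneApart-sym (inj₂ e) = inj₁ e

  far⇒¬OneApart : ∀ {i j} → 2 + i ≤ j → ¬ OneApart i j
  far⇒¬OneApart 2+i≤j   (inj₁ refl) = ℕ.1+n≰n 2+i≤j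
  far⇒¬OneApart 3+j≤j (inj₂ refl) = ℕ.1+n≰n (ℕ.≤-trans (ℕ.n≤1+n _) (ℕ.≤-trans (ℕ.n≤1+n _) 3+j≤j))

  far⇒≢ : ∀ {i j} → 2 + i ≤ j → i ≢ j
  far⇒≢ 2+i≤i refl = ℕ.1+n≰n (ℕ.≤-trans (ℕ.n≤1+n _) 2+i≤i)

  record InducedPath (G : Graph) (N : ℕ) : Set where
    field
      vertex    : ℕ → V G
      step      : ∀ {l} → l < N → Adj G (vertex l) (vertex (suc l))
      far-apart : ∀ {i j} → 2 + i ≤ j → j ≤ N → vertex i ≢ vertex j × ¬ Adj G (vertex i) (vertex j)

  InducedPath-transport : ∀ {H G N} → InducedSub H G → InducedPath H N → InducedPath G N
  InducedPath-transport (f , f-injective , f-induced) path = record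
    { vertex    = λ l → f (vertex l)
    ; step      = λ l<N → to (f-induced _ _) (step l<N)
    ; far-apart = λ 2+i≤j j≤N →
        let distinct , nonadjacent = far-apart 2+i≤j j≤N
        in (λ eq → distinct (f-injective _ _ eq)) , (λ adj → nonadjacent (from (f-induced _ _) adj))
    }
    where open InducedPath path

  induced-path-by-levels : ∀ {H N} (level : V H → ℕ) →
    (∀ {u v} → Adj H u v → OneApart (level u) (level v)) →
    (v : ℕ → V H) → (∀ {l} → l ≤ N → level (v l) ≡ l) →
    (∀ {l} → l < N → Adj H (v l) (v (suc l))) → InducedPath H N
  induced-path-by-levels level level-adj v level-v v-step = record
    { vertex    = v
    ; step      = v-step
    ; far-apart = λ {i} {j} 2+i≤j j≤N →
        let level-i = level-v (ℕ.≤-trans (ℕ.m≤n+m i 2) (ℕ.≤-trans 2+i≤j j≤N))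
            level-j = level-v j≤N
        in (λ vᵢ≡vⱼ → far⇒≢ 2+i≤j (trans (sym level-i) (trans (cong level vᵢ≡vⱼ) level-j)))
         , (λ adj → far⇒¬OneApart 2+i≤j (subst₂ OneApart level-i level-j (level-adj adj)))
    }

  clamp : ∀ n → ℕ → Fin (suc n)
  clamp n l = fromℕ< (s≤s (ℕ.m⊓n≤n l n))

  toℕ-clamp : ∀ {n l} → l ≤ n → toℕ (clamp n l) ≡ l
  toℕ-clamp l≤n = trans (toℕ-fromℕ< _) (ℕ.m≤n⇒m⊓n≡m l≤n)

  path-in-P : ∀ {N n} → N < n → InducedPath (P n) N
  path-in-P {n = suc n} (s≤s N≤n) = induced-path-by-levels toℕ id (clamp n)
    (λ l≤N → toℕ-clamp (ℕ.≤-trans l≤N N≤n))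
    (λ l<N → inj₁ (trans (cong suc (toℕ-clamp (ℕ.≤-trans (ℕ.<⇒≤ l<N) N≤n)))
                         (sym (toℕ-clamp (ℕ.≤-trans l<N N≤n)))))

  module _ {b k : ℕ} where

    -- Legs 2 and 3 are folded onto the same side, so that every edge joins consecutive levels.
    spider-level : SpiderV (suc b) (suc b) k → ℕ
    spider-level (leg1 i) = b ∸ toℕ i
    spider-level centre   = suc b
    spider-level (leg2 i) = toℕ i + suc (suc b)
    spider-level (leg3 i) = toℕ i + suc (suc b)

    private
      leg1-step : ∀ {i j : Fin (suc b)} → suc (toℕ i) ≡ toℕ j → OneApart (b ∸ toℕ i) (b ∸ toℕ j)
      leg1-step {i} {j} e = inj₂ (trans (sym (ℕ.+-∸-assoc 1 (s≤s⁻¹ (toℕ<n j)))) (cong (suc b ∸_) (sym e)))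

      leg-step : ∀ {m n} → suc m ≡ n → OneApart (m + suc (suc b)) (n + suc (suc b))
      leg-step e = inj₁ (cong (_+ suc (suc b)) e)

      centre-leg1 : ∀ {m} → m ≡ 0 → OneApart (suc b) (b ∸ m)
      centre-leg1 m≡0 = inj₂ (cong (λ x → suc (b ∸ x)) m≡0)

      centre-leg : ∀ {m} → m ≡ 0 → OneApart (suc b) (m + suc (suc b))
      centre-leg m≡0 = inj₁ (cong (_+ suc (suc b)) (sym m≡0))

    spider-level-adj : ∀ {u v} → SpiderAdj u v → OneApart (spider-level u) (spider-level v)
    spider-level-adj (c-1 i i≡0)       = centre-leg1 i≡0
    spider-level-adj (c-2 i i≡0)       = centre-leg i≡0
    spider-level-adj (c-3 i i≡0)       = centre-leg i≡0
    spider-level-adj (1-c i i≡0)       = OneApart-sym (centre-leg1 i≡0)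
    spider-level-adj (2-c i i≡0)       = OneApart-sym (centre-leg i≡0)
    spider-level-adj (3-c i i≡0)       = OneApart-sym (centre-leg i≡0)
    spider-level-adj (1-1 i j (inj₁ e)) = leg1-step e
    spider-level-adj (1-1 i j (inj₂ e)) = OneApart-sym (leg1-step e)
    spider-level-adj (2-2 i j (inj₁ e)) = leg-step e
    spider-level-adj (2-2 i j (inj₂ e)) = OneApart-sym (leg-step e)
    spider-level-adj (3-3 i j (inj₁ e)) = leg-step e
    spider-level-adj (3-3 i j (inj₂ e)) = OneApart-sym (leg-step e)

    spine : ℕ → SpiderV (suc b) (suc b) k
    spine l with ℕ.<-cmp l (suc b)
    ... | tri< _ _ _ = leg1 (clamp b (b ∸ l))
    ... | tri≈ _ _ _ = centre
    ... | tri> _ _ _ = leg2 (clamp b (l ∸ suc (suc b)))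

    private
      spine-left : ∀ {l} → l ≤ b → spine l ≡ leg1 (clamp b (b ∸ l))
      spine-left {l} l≤b with ℕ.<-cmp l (suc b)
      ... | tri< _ _ _  = refl
      ... | tri≈ l≮a _ _ = ⊥-elim (l≮a (s≤s l≤b))
      ... | tri> l≮a _ _ = ⊥-elim (l≮a (s≤s l≤b))

      spine-centre : spine (suc b) ≡ centre
      spine-centre with ℕ.<-cmp (suc b) (suc b)
      ... | tri< _ a≢a _ = ⊥-elim (a≢a refl)
      ... | tri≈ _ _ _   = refl
      ... | tri> _ a≢a _ = ⊥-elim (a≢a refl)

      spine-right : ∀ {l} → suc b < l → spine l ≡ leg2 (clamp b (l ∸ suc (suc b)))
      spine-right {l} a<l with ℕ.<-cmp l (suc b)
      ... | tri< _ _ l≯a = ⊥-elim (l≯a a<l)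
      ... | tri≈ _ _ l≯a = ⊥-elim (l≯a a<l)
      ... | tri> _ _ _   = refl

      right-bound : ∀ {l} → l ≤ suc b * 2 → l ∸ suc (suc b) ≤ b
      right-bound {l} l≤2a = ℕ.m≤n+o⇒m∸n≤o l (suc (suc b))
        (ℕ.≤-trans l≤2a (ℕ.≤-reflexive (cong (λ x → suc (suc x)) b*2≡b+b)))
        where b*2≡b+b = trans (ℕ.*-comm b 2) (cong (b +_) (ℕ.+-identityʳ b))

    spine-level : ∀ {l} → l ≤ suc b * 2 → spider-level (spine l) ≡ l
    spine-level {l} l≤2a with ℕ.<-cmp l (suc b)
    ... | tri< l<a _ _ = trans (cong (b ∸_) (toℕ-clamp (ℕ.m∸n≤m b l))) (ℕ.m∸[m∸n]≡n (s≤s⁻¹ l<a))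
    ... | tri≈ _ refl _ = refl
    ... | tri> _ _ a<l = trans (cong (_+ suc (suc b)) (toℕ-clamp (right-bound l≤2a))) (ℕ.m∸n+n≡m a<l)

    spine-step : ∀ {l} → l < suc b * 2 → SpiderAdj (spine l) (spine (suc l))
    spine-step {l} l<2a with ℕ.<-cmp l b
    ... | tri< l<b _ _ rewrite spine-left (ℕ.<⇒≤ l<b) | spine-left l<b =
      1-1 _ _ (inj₂ (trans (cong suc (toℕ-clamp (ℕ.m∸n≤m b (suc l))))
                    (trans (sym (ℕ.+-∸-assoc 1 l<b)) (sym (toℕ-clamp (ℕ.m∸n≤m b l))))))
    ... | tri≈ _ refl _ rewrite spine-left (ℕ.≤-refl {l}) | spine-centre =
      1-c _ (trans (toℕ-clamp (ℕ.m∸n≤m l l)) (ℕ.n∸n≡0 l))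
    ... | tri> _ _ b<l with ℕ.m≤n⇒m<n∨m≡n b<l
    ...   | inj₂ refl rewrite spine-centre | spine-right (ℕ.n<1+n (suc b)) =
      c-2 _ (trans (toℕ-clamp (ℕ.m∸n≤m b b)) (ℕ.n∸n≡0 b))
    ...   | inj₁ a<l rewrite spine-right a<l | spine-right (ℕ.m<n⇒m<1+n a<l) =
      2-2 _ _ (inj₁ (trans (cong suc (toℕ-clamp (right-bound (ℕ.<⇒≤ l<2a))))
                    (trans (sym (ℕ.+-∸-assoc 1 a<l)) (sym (toℕ-clamp (right-bound l<2a))))))

    path-in-spider : InducedPath (S (suc b) (suc b) k) (suc b * 2)
    path-in-spider = induced-path-by-levels spider-level spider-level-adj spine spine-level spine-step

  leg : Fin 3 → Fin 2 → SpiderV 2 2 2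
  leg 0F = leg1
  leg 1F = leg2
  leg 2F = leg3

  root-adj : ∀ x → SpiderAdj centre (leg x 0F)
  root-adj 0F = c-1 0F refl
  root-adj 1F = c-2 0F refl
  root-adj 2F = c-3 0F refl

  along-leg : ∀ x → SpiderAdj (leg x 0F) (leg x 1F)
  along-leg 0F = 1-1 0F 1F (inj₁ refl)
  along-leg 1F = 2-2 0F 1F (inj₁ refl)
  along-leg 2F = 3-3 0F 1F (inj₁ refl)

  roots-tips-apart : ∀ {x y} → x ≢ y → leg x 0F ≢ leg y 1F × ¬ SpiderAdj (leg x 0F) (leg y 1F)
  roots-tips-apart {0F} {0F} x≢y = ⊥-elim (x≢y refl)
  roots-tips-apart {1F} {1F} x≢y = ⊥-elim (x≢y refl)
  roots-tips-apart {2F} {2F} x≢y = ⊥-elim (x≢y refl)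
  roots-tips-apart {0F} {1F} _ = (λ ()) , (λ ())
  roots-tips-apart {0F} {2F} _ = (λ ()) , (λ ())
  roots-tips-apart {1F} {0F} _ = (λ ()) , (λ ())
  roots-tips-apart {1F} {2F} _ = (λ ()) , (λ ())
  roots-tips-apart {2F} {0F} _ = (λ ()) , (λ ())
  roots-tips-apart {2F} {1F} _ = (λ ()) , (λ ())

module _ where
  open import Data.Nat as ℕ using (ℕ; suc; z≤n; s≤s; _∸_; _<?_)
  import Data.Nat.Properties as ℕ
  open import Data.Integer using (ℤ; +_; -[1+_]; +≤+; 0ℤ; 1ℤ; _+_; _-_; _*_; -_)
  import Data.Integer.Properties as ℤ
  open import Data.Integer.Divisibility.Signed using (_∣_; ∣ᵤ⇒∣; ∣⇒∣ᵤ)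
  open import Data.Integer.Tactic.RingSolver using (solve-∀)
  open import Data.Fin using (toℕ)
  open import Data.Fin.Patterns using (0F; 1F)
  open import Data.Product using (_×_; _,_; proj₁; proj₂; ∃-syntax)
  open import Data.Sum using (inj₁; inj₂)
  open import Data.Empty using (⊥-elim)
  open import Function using (_∘_)
  open import Function.Bundles using (Equivalence)
  open import Relation.Binary.PropositionalEquality using (_≡_; _≢_; refl; sym; trans; cong; subst)
  open import Relation.Nullary using (¬_; yes; no)
  import Relation.Binary.Reasoning.Setoid as SetoidReasoning
  open Equivalence

  pos-∸ : ∀ {m n} → n ℕ.≤ m → + (m ∸ n) ≡ + m - + n
  pos-∸ {m} {n} n≤m = trans (sym (ℤ.⊖-≥ n≤m)) (sym (ℤ.m-n≡m⊖n m n))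

  module GqpArrows (q p : ℕ) (1≤q : 1 ℕ.≤ q) (2≤qp : 2 ℕ.≤ q ℕ.* p) where

    open Arrows q p public
    open SetoidReasoning ≈-setoid

    private
      modulus : + (q ℕ.* p ∸ 2) ≡ M
      modulus = trans (pos-∸ 2≤qp) (cong (_- + 2) (ℤ.pos-* q p))

      from-≡ₘ : ∀ {x y} → x ≡ₘ y [mod q ℕ.* p ∸ 2 ] → x ≈ y
      from-≡ₘ m∣x-y = by-divisibility (subst (_∣ _) modulus (∣ᵤ⇒∣ m∣x-y))

      to-≡ₘ : ∀ {x y} → x ≈ y → x ≡ₘ y [mod q ℕ.* p ∸ 2 ]
      to-≡ₘ (by-divisibility M∣x-y) = ∣⇒∣ᵤ (subst (_∣ _) (sym modulus) M∣x-y)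

      chord-length : ∀ {k} → 1 ℕ.≤ k → + (q ℕ.* k ∸ 1) ≡ D (+ k)
      chord-length {k} 1≤k = trans (pos-∸ (ℕ.*-mono-≤ 1≤q 1≤k)) (cong (_- 1ℤ) (ℤ.pos-* q k))

      backward : ∀ x → x - 1ℤ ≡ x + D 0ℤ
      backward x = lemma x (+ q)
        where lemma : ∀ x q → x - 1ℤ ≡ x + (q * 0ℤ - 1ℤ)
              lemma = solve-∀

      forward : ∀ x → x + 1ℤ ≡ x + D (+ p) + - 1ℤ * M
      forward x = lemma x (+ q) (+ p)
        where lemma : ∀ x q p → x + 1ℤ ≡ x + (q * p - 1ℤ) + - 1ℤ * (q * p - + 2)
              lemma = solve-∀

    adj⇒linked : ∀ {i j} → GAdj q p i j → Linked (+ toℕ i) (+ toℕ j)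
    adj⇒linked {i} (_ , inj₁ j≡i-1) =
      0ℤ , (ℤ.≤-refl , +≤+ z≤n) , ≈-trans (from-≡ₘ j≡i-1) (≈-reflexive (backward (+ toℕ i)))
    adj⇒linked {i} {j} (_ , inj₂ (inj₁ j≡i+1)) = + p , (+≤+ z≤n , ℤ.≤-refl) , (begin
      + toℕ j                          ≈⟨ from-≡ₘ j≡i+1 ⟩
      + toℕ i + 1ℤ                     ≡⟨ forward (+ toℕ i) ⟩
      + toℕ i + D (+ p) + - 1ℤ * M     ≈⟨ +-multiple _ (- 1ℤ) ⟩
      + toℕ i + D (+ p)                ∎)
    adj⇒linked {i} {j} (_ , inj₂ (inj₂ (k , 1≤k , k≤p-1 , j≡i+qk-1))) =
      + k , (+≤+ z≤n , +≤+ (ℕ.≤-trans k≤p-1 (ℕ.m∸n≤m p 1))) ,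
      subst (λ d → + toℕ j ≈ + toℕ i + d) (chord-length 1≤k) (from-≡ₘ j≡i+qk-1)

    linked⇒adj : ∀ {i j} → i ≢ j → Linked (+ toℕ i) (+ toℕ j) → GAdj q p i j
    linked⇒adj i≢j (-[1+ _ ] , (() , _) , _)
    linked⇒adj {i} {j} i≢j (+ k , (_ , +≤+ k≤p) , j≈) with k ℕ.≟ 0 | k ℕ.≟ p
    ... | yes refl | _ = i≢j , inj₁ (to-≡ₘ (≈-trans j≈ (≈-reflexive (sym (backward (+ toℕ i))))))
    ... | no _ | yes refl = i≢j , inj₂ (inj₁ (to-≡ₘ (begin
      + toℕ j                          ≈⟨ j≈ ⟩
      + toℕ i + D (+ p)                ≈⟨ ≈-sym (+-multiple _ (- 1ℤ)) ⟩
      + toℕ i + D (+ p) + - 1ℤ * M     ≡⟨ sym (forward (+ toℕ i)) ⟩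
      + toℕ i + 1ℤ                     ∎)))
    ... | no k≢0 | no k≢p = i≢j , inj₂ (inj₂ (k , 1≤k , k≤p-1 ,
            to-≡ₘ (subst (λ d → + toℕ j ≈ + toℕ i + d) (sym (chord-length 1≤k)) j≈)))
      where
        1≤k = ℕ.n≢0⇒n>0 k≢0
        k≤p-1 = subst (k ℕ.≤_) (ℕ.pred[m∸n]≡m∸[1+n] p 0) (ℕ.<⇒≤pred (ℕ.≤∧≢⇒< k≤p k≢p))

  Gqp-S222-free : ∀ q p → 1 ℕ.≤ q → 2 ℕ.≤ q ℕ.* p → S 2 2 2 -free Gqp q p
  Gqp-S222-free q p 1≤q 2≤qp (f , f-injective , f-induced) =
    let x , x′ , x≢x′ , linked = claw-linked {+ toℕ (f centre)} root tip
        distinct , nonadjacent = roots-tips-apart x≢x′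
    in nonadjacent (from (f-induced _ _) (linked⇒adj (distinct ∘ f-injective _ _) linked))
    where
      open GqpArrows q p 1≤q 2≤qp
      root : ∀ x → Linked (+ toℕ (f centre)) (+ toℕ (f (leg x 0F)))
      root x = adj⇒linked (to (f-induced _ _) (root-adj x))
      tip : ∀ x → Linked (+ toℕ (f (leg x 0F))) (+ toℕ (f (leg x 1F)))
      tip x = adj⇒linked (to (f-induced _ _) (along-leg x))

  module _ (c p : ℕ) (1≤c : 1 ℕ.≤ c) (1≤p : 1 ℕ.≤ p) where
    open Chains c p

    2≤qp : 2 ℕ.≤ q ℕ.* p
    2≤qp = ℕ.≤-trans (ℕ.n≤1+n 2) (ℕ.*-mono-≤ (s≤s (ℕ.*-monoˡ-≤ 2 1≤c)) 1≤p)

    open GqpArrows q p (s≤s z≤n) 2≤qp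

    Gqp-no-long-path : ¬ InducedPath (Gqp q p) N
    Gqp-no-long-path path = no-chain 1≤c 1≤p chain
      where
        open InducedPath path
        X : ℕ → ℤ
        X l = + toℕ (vertex l)
        arrow-at : ∀ l → ∃[ τ ] (τ ∈[ 0ℤ , + p ] × (l ℕ.< N → X (suc l) ≈ X l + D τ))
        arrow-at l with l <? N
        ... | yes l<N = let τ , τ∈ , X≈ = adj⇒linked (step l<N) in τ , τ∈ , λ _ → X≈
        ... | no  l≮N = 0ℤ , (ℤ.≤-refl , +≤+ z≤n) , λ l<N → ⊥-elim (l≮N l<N)
        chain : IsChain X (proj₁ ∘ arrow-at)
        chain = record
          { range    = proj₁ ∘ proj₂ ∘ arrow-at
          ; arrow    = λ {l} → proj₂ (proj₂ (arrow-at l))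
          ; unlinked = λ 2+i≤j j≤N linked →
              let distinct , nonadjacent = far-apart 2+i≤j j≤N
              in nonadjacent (linked⇒adj distinct linked)
          }

open import Data.Nat using (ℕ; suc; z≤n; s≤s; _+_; _*_; _∸_; _%_; _/_; _≤_; _<_; ⌊_/2⌋)
open import Data.Nat.DivMod using (m≡m%n+[m/n]*n)
open import Data.Nat.Properties using (n≤1+n; n≡⌊n+n/2⌋)
open import Data.Nat.Tactic.RingSolver using (solve-∀)
open import Data.Product using (_×_; _,_)
open import Relation.Binary.PropositionalEquality using (_≡_; refl; sym; trans; cong; subst)

odd-half : ∀ {q} → q % 2 ≡ 1 → q ≡ 1 + q / 2 * 2
odd-half {q} q-odd = trans (m≡m%n+[m/n]*n q 2) (cong (_+ q / 2 * 2) q-odd)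

path-length : ∀ c → c * 3 * 2 < 3 * (1 + c * 2) ∸ 1
path-length c = subst (λ n → c * 3 * 2 < n ∸ 1) (sym (lemma c)) (n≤1+n _)
  where lemma : ∀ c → 3 * (1 + c * 2) ≡ 3 + c * 3 * 2
        lemma = solve-∀

leg-length : ∀ c → ⌊ 3 * (1 + c * 2 ∸ 1) /2⌋ ≡ c * 3
leg-length c = trans (cong ⌊_/2⌋ (lemma c)) (sym (n≡⌊n+n/2⌋ (c * 3)))
  where lemma : ∀ c → 3 * (c * 2) ≡ c * 3 + c * 3
        lemma = solve-∀

lemma7 : (q : ℕ) → 3 ≤ q → q % 2 ≡ 1 → (p : ℕ) → 1 ≤ p →
    (P (3 * q ∸ 1) -free Gqp q p) ×
    (S 2 2 2 -free Gqp q p) ×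
    (S ⌊ 3 * (q ∸ 1) /2⌋ ⌊ 3 * (q ∸ 1) /2⌋ 1 -free Gqp q p)
lemma7 q 3≤q q-odd p 1≤p with q / 2 | odd-half {q} q-odd
lemma7 _ 3≤1 _ _ _ | 0 | refl with 3≤1
... | s≤s ()
lemma7 _ _ _ p 1≤p | suc c | refl =
  (λ embedding → no-long-path (InducedPath-transport embedding (path-in-P (path-length (suc c))))) ,
  Gqp-S222-free q p (s≤s z≤n) (2≤qp (suc c) p (s≤s z≤n) 1≤p) ,
  subst (λ a → S a a 1 -free Gqp q p) (sym (leg-length (suc c)))
        (λ embedding → no-long-path (InducedPath-transport embedding path-in-spider))
  where
    q = 1 + suc c * 2
    no-long-path = Gqp-no-long-path (suc c) p (s≤s z≤n) 1≤p
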